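{- Let $G$ be an infinite simple graph. Then either $\theta(G)=1$ or $\theta(G)=\infty$; that is, either $G$ is asymmetric, or for every positive integer $k$ there is a vertex coloring of $G$ using $k$ colors which is not distinguishing.
   Context: A vertex coloring is distinguishing if no non-identity automorphism of $G$ preserves it. The distinguishing threshold $\theta(G)$ is the minimum number $k$ such that every vertex coloring of $G$ with $k$ colors is distinguishing, with $\theta(G)=\infty$ if no finite such $k$ exists; equivalently $\theta(G)=1+\sup\{c(\alpha):\alpha\in\mathrm{Aut}(G)\}$, where $c(\alpha)$ is the number of cycles (fixed points included) of $\alpha$ and $c(\mathrm{id})=0$. -}

module Defs where

open import Data.Nat using (ℕ)
open import Data.Fin using (Fin)
open import Data.Product using (Σ; ∃; _×_; _,_)
open import Relation.Binary.PropositionalEquality using (_≡_)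
open import Relation.Nullary using (¬_)
open import Function.Bundles using (_↔_; Inverse)

record SimpleGraph : Set₁ where
  field
    V     : Set
    Adj   : V → V → Set
    sym   : ∀ {x y} → Adj x y → Adj y x
    irrefl : ∀ {x} → ¬ Adj x x

open SimpleGraph public

Infinite : Set → Set
Infinite A = ∀ (n : ℕ) → ¬ (A ↔ Fin n)

record Automorphism (G : SimpleGraph) : Set where
  field
    perm     : V G ↔ V G
    pres     : ∀ x y → Adj G x y → Adj G (Inverse.to perm x) (Inverse.to perm y)
    refl-adj : ∀ x y → Adj G (Inverse.to perm x) (Inverse.to perm y) → Adj G x y

open Automorphism public

app : {G : SimpleGraph} → Automorphism G → V G → V G
app α = Inverse.to (perm α)

NonIdentity : {G : SimpleGraph} → Automorphism G → Set
NonIdentity {G} α = ∃ λ (v : V G) → ¬ (app α v ≡ v)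

Asymmetric : SimpleGraph → Set
Asymmetric G = ∀ (α : Automorphism G) (v : V G) → app α v ≡ v

record Coloring (G : SimpleGraph) (k : ℕ) : Set where
  field
    col  : V G → Fin k
    onto : ∀ (i : Fin k) → ∃ λ (v : V G) → col v ≡ i

open Coloring public

Preserves : {G : SimpleGraph} {k : ℕ} → Automorphism G → Coloring G k → Set
Preserves {G} α c = ∀ (v : V G) → col c (app α v) ≡ col c v

Distinguishing : {G : SimpleGraph} {k : ℕ} → Coloring G k → Set
Distinguishing {G} c = ∀ (α : Automorphism G) → NonIdentity α → ¬ Preserves α c

{-# OPTIONS --safe #-}
-- If G is not asymmetric, fix a non-identity automorphism α. For each k ≥ 1 it suffices to find a
-- non-identity automorphism β and k vertices lying in pairwise distinct β-orbits: giving the i-th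
-- of these orbits color i and every other vertex color 0 yields a k-coloring preserved by β.
-- If some vertex x has an infinite α-orbit, take β = α^k; then x, αx, …, α^(k-1)x lie in distinct
-- β-orbits. Otherwise every α-orbit is finite, so as G is infinite α has infinitely many orbits,
-- and β = α works.
module Submission where

open import Defs hiding (sym)
open import Data.Nat using (ℕ; zero; suc; _+_; _*_; _%_; _/_; _≥_; _<_; NonZero)
open import Data.Nat.Properties using (+-comm; *-suc)
open import Data.Nat.DivMod using (m≡m%n+[m/n]*n; [m+kn]%n≡m%n; m<n⇒m%n≡m; m%n<n)
open import Data.Fin using (Fin; toℕ) renaming (zero to fzero; suc to fsuc)
open import Data.Fin.Properties using (toℕ-injective; toℕ<n)
open import Data.Vec.Functional using (Vector) renaming (_∷_ to _∷ᵥ_)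
open import Data.List using (List; _∷_; lookup; applyUpTo; tabulate; concat; deduplicate)
open import Data.List.Relation.Unary.Any using (index)
open import Data.List.Relation.Unary.Any.Properties using (lookup-index)
open import Data.List.Membership.Propositional using (_∈_)
open import Data.List.Membership.Propositional.Properties
  using (∈-lookup; ∈-applyUpTo⁺; ∈-concat⁺′; ∈-tabulate⁺; ∈-deduplicate⁺)
import Data.List.Membership.Setoid.Properties as SetoidMembership
open import Data.List.Relation.Unary.Unique.DecPropositional.Properties using (deduplicate-!)
open import Data.Product using (Σ; ∃; ∃₂; _×_; _,_; proj₁; proj₂)
open import Data.Sum using (_⊎_; inj₁; inj₂)
open import Data.Empty using (⊥-elim)
open import Relation.Nullary using (¬_; yes; no)
open import Relation.Binary.Definitions using (DecidableEquality)
open import Relation.Binary.PropositionalEquality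
  using (_≡_; _≢_; refl; sym; trans; cong; cong-app; subst; setoid; module ≡-Reasoning)
open import Function.Definitions using (Injective)
open import Function.Bundles using (_↔_; Inverse; Injection; mk↔ₛ′)
open import Function.Properties.Inverse using (↔⇒↣)
open import Axiom.ExcludedMiddle using (ExcludedMiddle)
open import Axiom.DoubleNegationElimination using (em⇒dne)
open import Axiom.UniquenessOfIdentityProofs using (module Decidable⇒UIP)
open import Level using (0ℓ)

a*k+i≡b*k+j⇒i≡j : ∀ {k i j} a b → i < k → j < k → a * k + i ≡ b * k + j → i ≡ j
a*k+i≡b*k+j⇒i≡j {suc k} {i} {j} a b i<k j<k eq = begin
  i                       ≡⟨ m<n⇒m%n≡m i<k ⟨
  i % suc k               ≡⟨ [m+kn]%n≡m%n i a (suc k) ⟨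
  (i + a * suc k) % suc k ≡⟨ cong (_% suc k) (trans (+-comm i _) (trans eq (+-comm _ j))) ⟩
  (j + b * suc k) % suc k ≡⟨ [m+kn]%n≡m%n j b (suc k) ⟩
  j % suc k               ≡⟨ m<n⇒m%n≡m j<k ⟩
  j                       ∎
  where open ≡-Reasoning

complete⇒↔Fin : {A : Set} → DecidableEquality A →
  (xs : List A) → (∀ x → x ∈ xs) → ∃ λ n → A ↔ Fin n
complete⇒↔Fin {A} _≟_ xs complete = _ , mk↔ₛ′ (λ x → index (∈ys x)) (lookup ys) to-from from-to
  where
  ys : List A
  ys = deduplicate _≟_ xs

  ∈ys : ∀ x → x ∈ ys
  ∈ys x = ∈-deduplicate⁺ _≟_ (complete x)

  index-∈-lookup : ∀ zs i → index (∈-lookup {xs = zs} i) ≡ i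
  index-∈-lookup (_ ∷ _)  fzero    = refl
  index-∈-lookup (_ ∷ zs) (fsuc i) = cong fsuc (index-∈-lookup zs i)

  to-from : ∀ i → index (∈ys (lookup ys i)) ≡ i
  to-from i = trans
    (cong index (SetoidMembership.unique⇒irrelevant (setoid A) (Decidable⇒UIP.≡-irrelevant _≟_)
       (deduplicate-! _≟_ xs) (∈ys (lookup ys i)) (∈-lookup i)))
    (index-∈-lookup ys i)

  from-to : ∀ x → lookup ys (index (∈ys x)) ≡ x
  from-to x = sym (lookup-index (∈ys x))

module _ {A : Set} where
  open import Function.Endo.Propositional A using (_^_; ^-homo; ∘-id-monoid)
  open import Algebra.Properties.Monoid.Mult ∘-id-monoid using (×-assocˡ)

  ^-+ : (f : A → A) (m n : ℕ) (x : A) → (f ^ (m + n)) x ≡ (f ^ m) ((f ^ n) x)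
  ^-+ f m n = cong-app (^-homo f m n)

  ^-* : (f : A → A) (m n : ℕ) (x : A) → ((f ^ n) ^ m) x ≡ (f ^ (m * n)) x
  ^-* f m n = cong-app (×-assocˡ f m n)

  ^-comm : (f : A → A) (m n : ℕ) (x : A) → (f ^ m) ((f ^ n) x) ≡ (f ^ n) ((f ^ m) x)
  ^-comm f m n x = begin
    (f ^ m) ((f ^ n) x) ≡⟨ ^-+ f m n x ⟨
    (f ^ (m + n)) x     ≡⟨ cong (λ k → (f ^ k) x) (+-comm m n) ⟩
    (f ^ (n + m)) x     ≡⟨ ^-+ f n m x ⟩
    (f ^ n) ((f ^ m) x) ∎
    where open ≡-Reasoning

  ^-inverse : {f g : A → A} → (∀ x → g (f x) ≡ x) → ∀ n x → (g ^ n) ((f ^ n) x) ≡ x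
  ^-inverse         g∘f≗id zero    x = refl
  ^-inverse {f} {g} g∘f≗id (suc n) x = begin
    g ((g ^ n) (f ((f ^ n) x))) ≡⟨ ^-comm g 1 n _ ⟩
    (g ^ n) (g (f ((f ^ n) x))) ≡⟨ cong (g ^ n) (g∘f≗id _) ⟩
    (g ^ n) ((f ^ n) x)         ≡⟨ ^-inverse g∘f≗id n x ⟩
    x                           ∎
    where open ≡-Reasoning

  ^-preserves : {R : A → A → Set} {f : A → A} →
    (∀ x y → R x y → R (f x) (f y)) → ∀ n x y → R x y → R ((f ^ n) x) ((f ^ n) y)
  ^-preserves f-pres zero    x y r = r
  ^-preserves f-pres (suc n) x y r = f-pres _ _ (^-preserves f-pres n x y r)

  ^-reflects : {R : A → A → Set} {f : A → A} →
    (∀ x y → R (f x) (f y) → R x y) → ∀ n x y → R ((f ^ n) x) ((f ^ n) y) → R x y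
  ^-reflects f-refl zero    x y r = r
  ^-reflects f-refl (suc n) x y r = ^-reflects f-refl n x y (f-refl _ _ r)

  module _ (f : A → A) where
    -- The orbit relation of the group generated by f, phrased with forward iterates only, so that
    -- it is an f-invariant equivalence relation without reference to an inverse of f.
    SameOrbit : A → A → Set
    SameOrbit x y = ∃₂ λ a b → (f ^ a) x ≡ (f ^ b) y

    sameOrbit-refl : ∀ {x} → SameOrbit x x
    sameOrbit-refl = 0 , 0 , refl

    sameOrbit-sym : ∀ {x y} → SameOrbit x y → SameOrbit y x
    sameOrbit-sym (a , b , p) = b , a , sym p

    sameOrbit-trans : ∀ {x y z} → SameOrbit x y → SameOrbit y z → SameOrbit x z
    sameOrbit-trans {x} {y} {z} (a , b , p) (c , d , q) = c + a , b + d , (begin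
      (f ^ (c + a)) x     ≡⟨ ^-+ f c a x ⟩
      (f ^ c) ((f ^ a) x) ≡⟨ cong (f ^ c) p ⟩
      (f ^ c) ((f ^ b) y) ≡⟨ ^-comm f c b y ⟩
      (f ^ b) ((f ^ c) y) ≡⟨ cong (f ^ b) q ⟩
      (f ^ b) ((f ^ d) z) ≡⟨ ^-+ f b d z ⟨
      (f ^ (b + d)) z     ∎)
      where open ≡-Reasoning

    sameOrbit-step : ∀ x → SameOrbit x (f x)
    sameOrbit-step x = 1 , 0 , refl

    DistinctOrbits : ∀ {k} → Vector A k → Set
    DistinctOrbits r = ∀ i j → SameOrbit (r i) (r j) → i ≡ j

    module OrbitColoring (em : ExcludedMiddle 0ℓ) {k} (r : Vector A (suc k)) (distinct : DistinctOrbits r) where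
      color : A → Fin (suc k)
      color x with em {∃ λ i → SameOrbit (r i) x}
      ... | yes (i , _) = i
      ... | no _        = fzero

      color-sameOrbit : ∀ {i x} → SameOrbit (r i) x → color x ≡ i
      color-sameOrbit {i} {x} s with em {∃ λ i → SameOrbit (r i) x}
      ... | yes (j , t) = distinct j i (sameOrbit-trans t (sameOrbit-sym s))
      ... | no ¬s       = ⊥-elim (¬s (i , s))

      color-outside : ∀ {x} → ¬ (∃ λ i → SameOrbit (r i) x) → color x ≡ fzero
      color-outside {x} ¬s with em {∃ λ i → SameOrbit (r i) x}
      ... | yes s = ⊥-elim (¬s s)
      ... | no _  = refl

      color-invariant : ∀ x → color (f x) ≡ color x
      color-invariant x with em {∃ λ i → SameOrbit (r i) x}
      ... | yes (i , s) = color-sameOrbit (sameOrbit-trans s (sameOrbit-step x))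
      ... | no ¬s       = color-outside λ (i , s) →
                            ¬s (i , sameOrbit-trans s (sameOrbit-sym (sameOrbit-step x)))

      color-rep : ∀ i → color (r i) ≡ i
      color-rep i = color-sameOrbit sameOrbit-refl

    aperiodic⇒^-injective : Injective _≡_ _≡_ f → ∀ {x} → (∀ n → (f ^ suc n) x ≢ x) →
      ∀ m n → (f ^ m) x ≡ (f ^ n) x → m ≡ n
    aperiodic⇒^-injective f-inj aperiodic zero    zero    _ = refl
    aperiodic⇒^-injective f-inj aperiodic zero    (suc n) p = ⊥-elim (aperiodic n (sym p))
    aperiodic⇒^-injective f-inj aperiodic (suc m) zero    p = ⊥-elim (aperiodic m p)
    aperiodic⇒^-injective f-inj aperiodic (suc m) (suc n) p =
      cong suc (aperiodic⇒^-injective f-inj aperiodic m n (f-inj p))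

    Periodic : Set
    Periodic = ∀ x → ∃ λ n → (f ^ suc n) x ≡ x

    ^-period : ∀ {p x} → (f ^ p) x ≡ x → ∀ q → (f ^ (q * p)) x ≡ x
    ^-period         fp zero    = refl
    ^-period {p} {x} fp (suc q) = begin
      (f ^ (p + q * p)) x       ≡⟨ ^-+ f p (q * p) x ⟩
      (f ^ p) ((f ^ (q * p)) x) ≡⟨ cong (f ^ p) (^-period fp q) ⟩
      (f ^ p) x                 ≡⟨ fp ⟩
      x                         ∎
      where open ≡-Reasoning

    ^-mod : ∀ {p x} .{{_ : NonZero p}} → (f ^ p) x ≡ x → ∀ j → (f ^ j) x ≡ (f ^ (j % p)) x
    ^-mod {p} {x} fp j = begin
      (f ^ j) x                             ≡⟨ cong (λ m → (f ^ m) x) (m≡m%n+[m/n]*n j p) ⟩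
      (f ^ (j % p + (j / p) * p)) x         ≡⟨ ^-+ f (j % p) _ x ⟩
      (f ^ (j % p)) ((f ^ ((j / p) * p)) x) ≡⟨ cong (f ^ (j % p)) (^-period fp (j / p)) ⟩
      (f ^ (j % p)) x                       ∎
      where open ≡-Reasoning

    periodic⇒sameOrbit⇒iterate : Periodic → ∀ {x y} → SameOrbit x y → ∃ λ j → (f ^ j) x ≡ y
    periodic⇒sameOrbit⇒iterate periodic {x} {y} (a , b , p) = b * n + a , (begin
      (f ^ (b * n + a)) x         ≡⟨ ^-+ f (b * n) a x ⟩
      (f ^ (b * n)) ((f ^ a) x)   ≡⟨ cong (f ^ (b * n)) p ⟩
      (f ^ (b * n)) ((f ^ b) y)   ≡⟨ ^-comm f (b * n) b y ⟩
      (f ^ b) ((f ^ (b * n)) y)   ≡⟨ ^-+ f b (b * n) y ⟨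
      (f ^ (b + b * n)) y         ≡⟨ cong (λ m → (f ^ m) y) (*-suc b n) ⟨
      (f ^ (b * suc n)) y         ≡⟨ ^-period (proj₂ (periodic y)) b ⟩
      y                           ∎)
      where
      open ≡-Reasoning
      n : ℕ
      n = proj₁ (periodic y)

    orbit : Periodic → A → List A
    orbit periodic x = applyUpTo (λ j → (f ^ j) x) (suc (proj₁ (periodic x)))

    sameOrbit⇒∈orbit : (periodic : Periodic) → ∀ {x y} → SameOrbit x y → y ∈ orbit periodic x
    sameOrbit⇒∈orbit periodic {x} s with periodic⇒sameOrbit⇒iterate periodic s
    ... | j , refl = subst (_∈ orbit periodic x)
                       (sym (^-mod (proj₂ (periodic x)) j))
                       (∈-applyUpTo⁺ (λ j → (f ^ j) x) (m%n<n j _))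

    ∷ᵥ-distinctOrbits : ∀ {m y} {r : Vector A m} →
      (∀ i → ¬ SameOrbit (r i) y) → DistinctOrbits r → DistinctOrbits (y ∷ᵥ r)
    ∷ᵥ-distinctOrbits new distinct fzero    fzero    _ = refl
    ∷ᵥ-distinctOrbits new distinct fzero    (fsuc j) s = ⊥-elim (new j (sameOrbit-sym s))
    ∷ᵥ-distinctOrbits new distinct (fsuc i) fzero    s = ⊥-elim (new i s)
    ∷ᵥ-distinctOrbits new distinct (fsuc i) (fsuc j) s = cong fsuc (distinct i j s)

    periodic⇒distinctOrbits : ExcludedMiddle 0ℓ → Infinite A → Periodic →
      ∀ m → Σ (Vector A m) DistinctOrbits
    periodic⇒distinctOrbits em infinite periodic zero = (λ ()) , λ ()
    periodic⇒distinctOrbits em infinite periodic (suc m)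
      with periodic⇒distinctOrbits em infinite periodic m
    ... | r , distinct with em {∃ λ y → ∀ i → ¬ SameOrbit (r i) y}
    ... | yes (y , new) = y ∷ᵥ r , ∷ᵥ-distinctOrbits new distinct
    ... | no ¬new = ⊥-elim (infinite _ (proj₂ (complete⇒↔Fin (λ _ _ → em) _ complete)))
      where
      complete : ∀ y → y ∈ concat (tabulate (λ i → orbit periodic (r i)))
      complete y with em⇒dne em (λ ¬covered → ¬new (y , λ i s → ¬covered (i , s)))
      ... | i , s = ∈-concat⁺′ (sameOrbit⇒∈orbit periodic s) (∈-tabulate⁺ i)

  aperiodic⇒distinctOrbits : {f : A → A} → Injective _≡_ _≡_ f → ∀ {x} → (∀ n → (f ^ suc n) x ≢ x) →
    ∀ k → DistinctOrbits (f ^ k) (λ (i : Fin k) → (f ^ toℕ i) x)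
  aperiodic⇒distinctOrbits {f} f-inj {x} aperiodic k i j (a , b , p) =
    toℕ-injective (a*k+i≡b*k+j⇒i≡j a b (toℕ<n i) (toℕ<n j)
      (aperiodic⇒^-injective f f-inj aperiodic _ _ (trans (sym (along a i)) (trans p (along b j)))))
    where
    along : ∀ a (i : Fin k) → ((f ^ k) ^ a) ((f ^ toℕ i) x) ≡ (f ^ (a * k + toℕ i)) x
    along a i = trans (^-* f a k _) (sym (^-+ f (a * k) (toℕ i) x))

module _ {G : SimpleGraph} where
  open import Function.Endo.Propositional (V G) using (_^_)

  _^ᴬ_ : Automorphism G → ℕ → Automorphism G
  α ^ᴬ n = record
    { perm     = mk↔ₛ′ (app α ^ n) (Inverse.from (perm α) ^ n)
                   (^-inverse (Inverse.strictlyInverseˡ (perm α)) n)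
                   (^-inverse (Inverse.strictlyInverseʳ (perm α)) n)
    ; pres     = ^-preserves (pres α) n
    ; refl-adj = ^-reflects (refl-adj α) n
    }

  ¬asymmetric⇒nonIdentity : ExcludedMiddle 0ℓ → ¬ Asymmetric G → ∃ λ (α : Automorphism G) → NonIdentity α
  ¬asymmetric⇒nonIdentity em ¬asymmetric =
    em⇒dne em λ ¬∃ → ¬asymmetric λ α v → em⇒dne em λ αv≢v → ¬∃ (α , v , αv≢v)

  nonIdentity⇒distinctOrbits : ExcludedMiddle 0ℓ → Infinite (V G) → (α : Automorphism G) → NonIdentity α →
    ∀ k → ∃ λ (β : Automorphism G) → NonIdentity β × Σ (Vector (V G) (suc k)) (DistinctOrbits (app β))
  nonIdentity⇒distinctOrbits em infinite α α≢id k with em {∃ λ x → ∀ n → (app α ^ suc n) x ≢ x}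
  ... | yes (x , aperiodic) = α ^ᴬ suc k , (x , aperiodic k) ,
          _ , aperiodic⇒distinctOrbits (Injection.injective (↔⇒↣ (perm α))) aperiodic (suc k)
  ... | no ¬aperiodic = α , α≢id , periodic⇒distinctOrbits (app α) em infinite periodic (suc k)
    where
    periodic : Periodic (app α)
    periodic x = em⇒dne em λ ¬periodic → ¬aperiodic (x , λ n p → ¬periodic (n , p))

  invariantColoring : ExcludedMiddle 0ℓ → (β : Automorphism G) → ∀ {k} (r : Vector (V G) (suc k)) →
    DistinctOrbits (app β) r → ∃ λ (c : Coloring G (suc k)) → Preserves β c
  invariantColoring em β r distinct =
    record { col = color ; onto = λ i → r i , color-rep i } , color-invariant
    where open OrbitColoring (app β) em r distinct

theorem3p9 : ExcludedMiddle 0ℓ → (G : SimpleGraph) → Infinite (V G) →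
    Asymmetric G ⊎ (∀ (k : ℕ) → k ≥ 1 → ∃ λ (c : Coloring G k) → ¬ Distinguishing c)
theorem3p9 em G infinite with em {Asymmetric G}
... | yes asymmetric = inj₁ asymmetric
... | no ¬asymmetric = inj₂ λ where
  (suc k) _ →
    let α , α≢id                = ¬asymmetric⇒nonIdentity em ¬asymmetric
        β , β≢id , r , distinct = nonIdentity⇒distinctOrbits em infinite α α≢id k
        c , β-preserves-c       = invariantColoring em β r distinct
    in c , λ distinguishing → distinguishing β β≢id β-preserves-c
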